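{- Let $m\geq 2$ be an integer, $d=2^m$, and let $C\subseteq\mathbb{Z}_4^d$ be a $\mathbb{Z}_4$-linear code of length $d$ such that the set $\{(n_0(x)-n_2(x))+\sqrt{ -1}(n_1(x)-n_3(x)) : x\in C\}$ equals $\{\pm d,\pm\sqrt{ -1}d,0,\pm b,\pm\sqrt{ -1}b\}$ for some $0<b<d$, and such that $C$ contains the first order $\mathbb{Z}_4$-Reed–Muller code $ZRM(1,m)$ as a subcode. Let $\{u_1,\ldots,u_f\}$ be a complete set of coset representatives of $C/ZRM(1,m)$. Then $\{\psi\circ\phi(u_1+ZRM(1,m)),\ldots,\psi\circ\phi(u_f+ZRM(1,m))\}$ is a cross polytope decomposition of $\psi\circ\phi(C)\subset\mathbb{R}^{2d}$.
   Context: For $x\in\mathbb{Z}_4^d$ and $i\in\{0,1,2,3\}$, $n_i(x)$ is the number of coordinates of $x$ equal to $i$. The Gray map $\phi:\mathbb{Z}_4\to\mathbb{Z}_2^2$ is $\phi(0)=(0,0)$, $\phi(1)=(0,1)$, $\phi(2)=(1,1)$, $\phi(3)=(1,0)$, extended componentwise to $\phi:\mathbb{Z}_4^d\to\mathbb{Z}_2^{2d}$. $\psi:\mathbb{Z}_2^{n}\to\{\pm1\}^n\subset\mathbb{R}^n$ is $\psi((x_i))=((-1)^{x_i})$. The first order $\mathbb{Z}_4$-Reed–Muller code $ZRM(1,m)$ is the $\mathbb{Z}_4$-linear code of length $2^m$ (coordinates indexed by $\mathbb{F}_2^m$) generated by the all-ones vector and the vectors $2v_1,\ldots,2v_m$,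 where $v_j\in\{0,1\}^{2^m}$ has $x$-coordinate equal to the $j$-th coordinate of $x\in\mathbb{F}_2^m$. A cross polytope decomposition of a finite set $X\subset\mathbb{R}^{n}$ is a partition of $X$ into sets each of the form $\{\pm v_1,\ldots,\pm v_n\}$ with $v_1,\ldots,v_n$ pairwise orthogonal nonzero vectors of equal norm. -}

module Defs where

open import Data.Nat as ℕ using (ℕ; zero; suc; ⌊_/2⌋; _^_; _*_)
open import Data.Integer as ℤ using (ℤ; +_; -_)
open import Data.Fin using (Fin; toℕ)
open import Data.Vec using (Vec; []; _∷_; map; zipWith; replicate; tabulate; concat; foldr)
open import Data.Bool using (Bool; true; false; not; if_then_else_)
open import Data.List using (List) renaming (_∷_ to _∷ᴸ_; [] to []ᴸ)
open import Data.List.Membership.Propositional using (_∈_)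
open import Data.Product using (_×_; _,_; ∃; Σ)
open import Data.Sum using (_⊎_)
open import Function.Bundles using (_⇔_)
open import Relation.Binary.PropositionalEquality using (_≡_; _≢_)
open import Relation.Nullary using (¬_)

data ℤ₄ : Set where
  𝟘 𝟙 𝟚 𝟛 : ℤ₄

infixl 6 _+₄_
_+₄_ : ℤ₄ → ℤ₄ → ℤ₄
𝟘 +₄ y = y
𝟙 +₄ 𝟘 = 𝟙
𝟙 +₄ 𝟙 = 𝟚
𝟙 +₄ 𝟚 = 𝟛
𝟙 +₄ 𝟛 = 𝟘
𝟚 +₄ 𝟘 = 𝟚
𝟚 +₄ 𝟙 = 𝟛
𝟚 +₄ 𝟚 = 𝟘
𝟚 +₄ 𝟛 = 𝟙
𝟛 +₄ 𝟘 = 𝟛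
𝟛 +₄ 𝟙 = 𝟘
𝟛 +₄ 𝟚 = 𝟙
𝟛 +₄ 𝟛 = 𝟚

-₄_ : ℤ₄ → ℤ₄
-₄ 𝟘 = 𝟘
-₄ 𝟙 = 𝟛
-₄ 𝟚 = 𝟚
-₄ 𝟛 = 𝟙

infixl 7 _*₄_
_*₄_ : ℤ₄ → ℤ₄ → ℤ₄
𝟘 *₄ y = 𝟘
𝟙 *₄ y = y
𝟚 *₄ y = y +₄ y
𝟛 *₄ y = -₄ y

_==₄_ : ℤ₄ → ℤ₄ → Bool
𝟘 ==₄ 𝟘 = true
𝟙 ==₄ 𝟙 = true
𝟚 ==₄ 𝟚 = true
𝟛 ==₄ 𝟛 = true
_ ==₄ _ = false

Word : ℕ → Set
Word d = Vec ℤ₄ d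

infixl 6 _⊕_ _⊖_
_⊕_ : ∀ {d} → Word d → Word d → Word d
_⊕_ = zipWith _+₄_

_⊖_ : ∀ {d} → Word d → Word d → Word d
x ⊖ y = x ⊕ map -₄_ y

_·_ : ∀ {d} → ℤ₄ → Word d → Word d
a · x = map (a *₄_) x

0w : ∀ {d} → Word d
0w = replicate _ 𝟘

1w : ∀ {d} → Word d
1w = replicate _ 𝟙

nᵢ : ℤ₄ → ∀ {d} → Word d → ℕ
nᵢ a [] = 0
nᵢ a (x ∷ xs) = if x ==₄ a then suc (nᵢ a xs) else nᵢ a xs

-- (n₀(x) - n₂(x)) + √-1 (n₁(x) - n₃(x)), as (real part , imaginary part)
wt : ∀ {d} → Word d → ℤ × ℤ
wt x = ((+ nᵢ 𝟘 x) ℤ.- (+ nᵢ 𝟚 x)) , ((+ nᵢ 𝟙 x) ℤ.- (+ nᵢ 𝟛 x))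

IsLinearCode : ∀ {d} → (Word d → Set) → Set
IsLinearCode C =
  C 0w × (∀ x y → C x → C y → C (x ⊕ y)) × (∀ a x → C x → C (a · x))

-- First order ℤ₄-Reed–Muller code ZRM(1,m).
-- Coordinates Fin (2^m) are identified with 𝔽₂^m via binary expansion:
-- the j-th coordinate of the point indexed by i is the j-th binary digit of i.

odd : ℕ → Bool
odd zero = false
odd (suc n) = not (odd n)

bit : ℕ → ℕ → Bool
bit n zero = odd n
bit n (suc j) = bit ⌊ n /2⌋ j

twoV : (m : ℕ) → Fin m → Word (2 ^ m)
twoV m j = tabulate (λ i → if bit (toℕ i) (toℕ j) then 𝟚 else 𝟘)

data ZRM (m : ℕ) : Word (2 ^ m) → Set where
  zrm-0 : ZRM m 0w
  zrm-1 : ∀ {x} → ZRM m x → ZRM m (x ⊕ 1w)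
  zrm-v : ∀ {x} (j : Fin m) → ZRM m x → ZRM m (x ⊕ twoV m j)

φ₁ : ℤ₄ → Vec Bool 2
φ₁ 𝟘 = false ∷ false ∷ []
φ₁ 𝟙 = false ∷ true ∷ []
φ₁ 𝟚 = true ∷ true ∷ []
φ₁ 𝟛 = true ∷ false ∷ []

φ : ∀ {d} → Word d → Vec Bool (d * 2)
φ x = concat (map φ₁ x)

ψ : ∀ {n} → Vec Bool n → Vec ℤ n
ψ = map (λ b → if b then ℤ.-1ℤ else ℤ.1ℤ)

ψφ : ∀ {d} → Word d → Vec ℤ (d * 2)
ψφ x = ψ (φ x)

ψφ[_] : ∀ {d} → (Word d → Set) → Vec ℤ (d * 2) → Set
ψφ[ S ] y = ∃ λ x → S x × y ≡ ψφ x

coset : ∀ {m} → Word (2 ^ m) → Word (2 ^ m) → Set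
coset {m} u x = ∃ λ z → ZRM m z × x ≡ u ⊕ z

-- Cross polytope decompositions (vectors with integer entries, viewed in ℝⁿ;
-- all vectors involved have ±1 entries, so inner products are exact in ℤ)

dot : ∀ {n} → Vec ℤ n → Vec ℤ n → ℤ
dot u v = foldr _ ℤ._+_ (+ 0) (zipWith ℤ._*_ u v)

neg : ∀ {n} → Vec ℤ n → Vec ℤ n
neg = map -_

IsCrossPolytope : (n : ℕ) → (Vec ℤ n → Set) → Set
IsCrossPolytope n P =
  Σ (Fin n → Vec ℤ n) λ v →
    (∀ k → v k ≢ replicate n (+ 0)) ×
    (∀ k l → k ≢ l → dot (v k) (v l) ≡ + 0) ×
    (∀ k l → dot (v k) (v k) ≡ dot (v l) (v l)) ×
    (∀ y → P y ⇔ (∃ λ k → y ≡ v k ⊎ y ≡ neg (v k)))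

IsCrossPolytopeDecomposition : (n : ℕ) → (Vec ℤ n → Set) →
                               (f : ℕ) → (Fin f → Vec ℤ n → Set) → Set
IsCrossPolytopeDecomposition n X f P =
  (∀ i → IsCrossPolytope n (P i)) ×
  (∀ i j y → P i y → P j y → i ≡ j) ×
  (∀ y → X y ⇔ (∃ λ i → P i y))

valueList : ℕ → ℕ → List (ℤ × ℤ)
valueList d b =
  (+ d , + 0) ∷ᴸ (- + d , + 0) ∷ᴸ (+ 0 , + d) ∷ᴸ (+ 0 , - + d) ∷ᴸ (+ 0 , + 0) ∷ᴸ
  (+ b , + 0) ∷ᴸ (- + b , + 0) ∷ᴸ (+ 0 , + b) ∷ᴸ (+ 0 , - + b) ∷ᴸ []ᴸ

ValueSetIs : ∀ {d} → (Word d → Set) → List (ℤ × ℤ) → Set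
ValueSetIs C V = ∀ z → (∃ λ x → C x × wt x ≡ z) ⇔ z ∈ V

IsCosetReps : ∀ {m} → (Word (2 ^ m) → Set) → (f : ℕ) → (Fin f → Word (2 ^ m)) → Set
IsCosetReps {m} C f u =
  (∀ i → C (u i)) ×
  (∀ x → C x → ∃ λ i → ZRM m (x ⊖ u i)) ×
  (∀ i j → ZRM m (u i ⊖ u j) → i ≡ j)

module Submission where

-- Every coset u + ZRM(1,m) is mapped by ψ∘φ onto a cross polytope; the
-- cosets of ZRM(1,m) in C partition C, and ψ∘φ is injective, so their
-- images partition ψ∘φ(C).  (The hypotheses on the weight values of C are
-- not needed for this.)

open import Defs
open import Data.Nat using (ℕ; _^_; _≤_; _<_; _*_)
open import Data.Fin using (Fin)

open import Data.Nat using (zero; suc; _+_; ⌊_/2⌋; z≤n; s≤s)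
import Data.Nat.Properties as ℕP
open import Data.Integer as ℤ using (ℤ; +_)
import Data.Integer.Properties as ℤP
open import Data.Fin using (zero; suc; toℕ; fromℕ<)
import Data.Fin.Properties as FinP
open import Data.Vec using (Vec; []; _∷_; _++_; map; zipWith; replicate; tabulate)
import Data.Vec.Properties as VecP
open import Data.Bool using (Bool; true; false; not; _∧_; _xor_; if_then_else_)
import Data.Bool.Properties as BoolP
open import Data.Product using (_×_; _,_; ∃; ∃₂)
open import Data.Sum using (_⊎_; inj₁; inj₂)
open import Data.Empty using (⊥-elim)
open import Function using (_∘_)
open import Function.Bundles using (_⇔_; mk⇔)
open import Relation.Binary.Definitions using (DecidableEquality)
open import Relation.Binary.PropositionalEquality
open import Relation.Nullary using (Dec; yes; no)
open import Relation.Nullary.Decidable using (map′; _×-dec_; _→-dec_; ¬?; from-yes)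
open import Algebra.Properties.CommutativeSemigroup ℤP.+-commutativeSemigroup
  using () renaming (interchange to ℤ+-interchange)

infix 4 _≟₄_
_≟₄_ : DecidableEquality ℤ₄
𝟘 ≟₄ 𝟘 = yes refl
𝟘 ≟₄ 𝟙 = no λ ()
𝟘 ≟₄ 𝟚 = no λ ()
𝟘 ≟₄ 𝟛 = no λ ()
𝟙 ≟₄ 𝟘 = no λ ()
𝟙 ≟₄ 𝟙 = yes refl
𝟙 ≟₄ 𝟚 = no λ ()
𝟙 ≟₄ 𝟛 = no λ ()
𝟚 ≟₄ 𝟘 = no λ ()
𝟚 ≟₄ 𝟙 = no λ ()
𝟚 ≟₄ 𝟚 = yes refl
𝟚 ≟₄ 𝟛 = no λ ()
𝟛 ≟₄ 𝟘 = no λ ()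
𝟛 ≟₄ 𝟙 = no λ ()
𝟛 ≟₄ 𝟚 = no λ ()
𝟛 ≟₄ 𝟛 = yes refl

∀ℤ₄? : {P : ℤ₄ → Set} → (∀ a → Dec (P a)) → Dec (∀ a → P a)
∀ℤ₄? {P} P? = map′ every (λ f → f 𝟘 , f 𝟙 , f 𝟚 , f 𝟛) (P? 𝟘 ×-dec P? 𝟙 ×-dec P? 𝟚 ×-dec P? 𝟛)
  where
  every : P 𝟘 × P 𝟙 × P 𝟚 × P 𝟛 → ∀ a → P a
  every (p , _ , _ , _) 𝟘 = p
  every (_ , p , _ , _) 𝟙 = p
  every (_ , _ , p , _) 𝟚 = p
  every (_ , _ , _ , p) 𝟛 = p

∀𝔹? : {P : Bool → Set} → (∀ b → Dec (P b)) → Dec (∀ b → P b)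
∀𝔹? {P} P? = map′ every (λ f → f false , f true) (P? false ×-dec P? true)
  where
  every : P false × P true → ∀ b → P b
  every (p , _) false = p
  every (_ , p) true = p

once : Bool → ℤ₄
once b = if b then 𝟙 else 𝟘

twice : Bool → ℤ₄
twice b = if b then 𝟚 else 𝟘

once+twice : ∀ c → ∃₂ λ b e → c ≡ once b +₄ twice e
once+twice 𝟘 = false , false , refl
once+twice 𝟙 = true , false , refl
once+twice 𝟚 = false , true , refl
once+twice 𝟛 = true , true , refl

+₄-identityʳ : ∀ a → a +₄ 𝟘 ≡ a
+₄-identityʳ = from-yes (∀ℤ₄? λ a → a +₄ 𝟘 ≟₄ a)

+₄-assoc : ∀ a b c → (a +₄ b) +₄ c ≡ a +₄ (b +₄ c)
+₄-assoc = from-yes (∀ℤ₄? λ a → ∀ℤ₄? λ b → ∀ℤ₄? λ c → (a +₄ b) +₄ c ≟₄ a +₄ (b +₄ c))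

−₄-self : ∀ a → a +₄ -₄ a ≡ 𝟘
−₄-self = from-yes (∀ℤ₄? λ a → a +₄ -₄ a ≟₄ 𝟘)

+₄-−₄-cancel : ∀ a b → (a +₄ b) +₄ -₄ a ≡ b
+₄-−₄-cancel = from-yes (∀ℤ₄? λ a → ∀ℤ₄? λ b → (a +₄ b) +₄ -₄ a ≟₄ b)

+₄-difference : ∀ a b → a +₄ (b +₄ -₄ a) ≡ b
+₄-difference = from-yes (∀ℤ₄? λ a → ∀ℤ₄? λ b → a +₄ (b +₄ -₄ a) ≟₄ b)

−₄-common-minuend : ∀ x a b → (x +₄ -₄ a) +₄ -₄ (x +₄ -₄ b) ≡ b +₄ -₄ a
−₄-common-minuend = from-yes (∀ℤ₄? λ x → ∀ℤ₄? λ a → ∀ℤ₄? λ b →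
  (x +₄ -₄ a) +₄ -₄ (x +₄ -₄ b) ≟₄ b +₄ -₄ a)

−₄-translate : ∀ u z z′ → (u +₄ z′) +₄ -₄ (u +₄ z) ≡ z′ +₄ -₄ z
−₄-translate = from-yes (∀ℤ₄? λ u → ∀ℤ₄? λ z → ∀ℤ₄? λ z′ →
  (u +₄ z′) +₄ -₄ (u +₄ z) ≟₄ z′ +₄ -₄ z)

twice-+₄ : ∀ p q → twice p +₄ twice q ≡ twice (p xor q)
twice-+₄ = from-yes (∀𝔹? λ p → ∀𝔹? λ q → twice p +₄ twice q ≟₄ twice (p xor q))

shifted-+₄ : ∀ c c′ p p′ → (c +₄ twice p) +₄ (c′ +₄ twice p′) ≡ (c +₄ c′) +₄ twice (p xor p′)
shifted-+₄ = from-yes (∀ℤ₄? λ c → ∀ℤ₄? λ c′ → ∀𝔹? λ p → ∀𝔹? λ p′ →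
  (c +₄ twice p) +₄ (c′ +₄ twice p′) ≟₄ (c +₄ c′) +₄ twice (p xor p′))

shifted-−₄ : ∀ c p → -₄ (c +₄ twice p) ≡ -₄ c +₄ twice p
shifted-−₄ = from-yes (∀ℤ₄? λ c → ∀𝔹? λ p → -₄ (c +₄ twice p) ≟₄ -₄ c +₄ twice p)

⊕-identityˡ : ∀ {d} (x : Word d) → 0w ⊕ x ≡ x
⊕-identityˡ [] = refl
⊕-identityˡ (a ∷ x) = cong (a ∷_) (⊕-identityˡ x)

⊕-identityʳ : ∀ {d} (x : Word d) → x ⊕ 0w ≡ x
⊕-identityʳ [] = refl
⊕-identityʳ (a ∷ x) = cong₂ _∷_ (+₄-identityʳ a) (⊕-identityʳ x)

⊕-assoc : ∀ {d} (x y z : Word d) → (x ⊕ y) ⊕ z ≡ x ⊕ (y ⊕ z)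
⊕-assoc [] [] [] = refl
⊕-assoc (a ∷ x) (b ∷ y) (c ∷ z) = cong₂ _∷_ (+₄-assoc a b c) (⊕-assoc x y z)

⊖-self : ∀ {d} (x : Word d) → x ⊖ x ≡ 0w
⊖-self [] = refl
⊖-self (a ∷ x) = cong₂ _∷_ (−₄-self a) (⊖-self x)

⊕-⊖-cancel : ∀ {d} (u z : Word d) → (u ⊕ z) ⊖ u ≡ z
⊕-⊖-cancel [] [] = refl
⊕-⊖-cancel (a ∷ u) (b ∷ z) = cong₂ _∷_ (+₄-−₄-cancel a b) (⊕-⊖-cancel u z)

⊕-difference : ∀ {d} (u x : Word d) → u ⊕ (x ⊖ u) ≡ x
⊕-difference [] [] = refl
⊕-difference (a ∷ u) (b ∷ x) = cong₂ _∷_ (+₄-difference a b) (⊕-difference u x)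

⊖-common-minuend : ∀ {d} (x a b : Word d) → (x ⊖ a) ⊖ (x ⊖ b) ≡ b ⊖ a
⊖-common-minuend [] [] [] = refl
⊖-common-minuend (x₀ ∷ x) (a₀ ∷ a) (b₀ ∷ b) =
  cong₂ _∷_ (−₄-common-minuend x₀ a₀ b₀) (⊖-common-minuend x a b)

⊖-translate : ∀ {d} (u z z′ : Word d) → (u ⊕ z′) ⊖ (u ⊕ z) ≡ z′ ⊖ z
⊖-translate [] [] [] = refl
⊖-translate (a ∷ u) (b ∷ z) (c ∷ z′) = cong₂ _∷_ (−₄-translate a b c) (⊖-translate u z z′)

tabulate-const : ∀ {d} (a : ℤ₄) → tabulate {n = d} (λ _ → a) ≡ replicate d a
tabulate-const {zero} a = refl
tabulate-const {suc d} a = cong (a ∷_) (tabulate-const a)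

⊕-tabulate : ∀ {d} (f g : Fin d → ℤ₄) → tabulate f ⊕ tabulate g ≡ tabulate (λ i → f i +₄ g i)
⊕-tabulate {zero} f g = refl
⊕-tabulate {suc d} f g = cong (f zero +₄ g zero ∷_) (⊕-tabulate (f ∘ suc) (g ∘ suc))

zrm-⊕ : ∀ {m x y} → ZRM m x → ZRM m y → ZRM m (x ⊕ y)
zrm-⊕ {x = x} x∈ zrm-0 = subst (ZRM _) (sym (⊕-identityʳ x)) x∈
zrm-⊕ {x = x} x∈ (zrm-1 {y} y∈) = subst (ZRM _) (⊕-assoc x y 1w) (zrm-1 (zrm-⊕ x∈ y∈))
zrm-⊕ {m} {x} x∈ (zrm-v {y} j y∈) =
  subst (ZRM _) (⊕-assoc x y (twoV m j)) (zrm-v j (zrm-⊕ x∈ y∈))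

add-one : ∀ {m c} → ZRM m (replicate (2 ^ m) c) → ZRM m (replicate (2 ^ m) (c +₄ 𝟙))
add-one {c = c} c∈ = subst (ZRM _) (VecP.zipWith-replicate _+₄_ c 𝟙) (zrm-1 c∈)

replicate-zrm : ∀ {m} c → ZRM m (replicate (2 ^ m) c)
replicate-zrm 𝟘 = zrm-0
replicate-zrm 𝟙 = add-one zrm-0
replicate-zrm 𝟚 = add-one (add-one zrm-0)
replicate-zrm 𝟛 = add-one (add-one (add-one zrm-0))

twoV-zrm : ∀ {m} (j : Fin m) → ZRM m (twoV m j)
twoV-zrm {m} j = subst (ZRM m) (⊕-identityˡ (twoV m j)) (zrm-v j zrm-0)

-- Inner products over 𝔽₂.  xorsum β h = Σ_j β_j h_j, and inner β n is the
-- inner product of β with the binary digits of n (least significant first).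

_⊻_ : ∀ {t} → Vec Bool t → Vec Bool t → Vec Bool t
_⊻_ = zipWith _xor_

zeros : ∀ {t} → Vec Bool t
zeros = replicate _ false

single : ∀ {t} → Fin t → Vec Bool t
single zero = true ∷ zeros
single (suc j) = false ∷ single j

xorsum : ∀ {t} → Vec Bool t → (Fin t → Bool) → Bool
xorsum [] h = false
xorsum (b ∷ β) h = (b ∧ h zero) xor xorsum β (h ∘ suc)

xorsum-⊻ : ∀ {t} (β β′ : Vec Bool t) h → xorsum (β ⊻ β′) h ≡ xorsum β h xor xorsum β′ h
xorsum-⊻ [] [] h = refl
xorsum-⊻ (b ∷ β) (b′ ∷ β′) h =
  trans (cong (((b xor b′) ∧ h zero) xor_) (xorsum-⊻ β β′ (h ∘ suc)))
        (distrib b b′ (h zero) (xorsum β (h ∘ suc)) (xorsum β′ (h ∘ suc)))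
  where
  distrib : ∀ x y o P Q → ((x xor y) ∧ o) xor (P xor Q) ≡ ((x ∧ o) xor P) xor ((y ∧ o) xor Q)
  distrib = from-yes (∀𝔹? λ x → ∀𝔹? λ y → ∀𝔹? λ o → ∀𝔹? λ P → ∀𝔹? λ Q →
    ((x xor y) ∧ o) xor (P xor Q) BoolP.≟ ((x ∧ o) xor P) xor ((y ∧ o) xor Q))

xorsum-zeros : ∀ {t} (h : Fin t → Bool) → xorsum zeros h ≡ false
xorsum-zeros {zero} h = refl
xorsum-zeros {suc t} h = xorsum-zeros (h ∘ suc)

xorsum-single : ∀ {t} (j : Fin t) h → xorsum (single j) h ≡ h j
xorsum-single zero h =
  trans (cong (h zero xor_) (xorsum-zeros (h ∘ suc))) (BoolP.xor-identityʳ (h zero))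
xorsum-single (suc j) h = xorsum-single j (h ∘ suc)

⊻-identityʳ : ∀ {t} (β : Vec Bool t) → β ⊻ zeros ≡ β
⊻-identityʳ [] = refl
⊻-identityʳ (b ∷ β) = cong₂ _∷_ (BoolP.xor-identityʳ b) (⊻-identityʳ β)

⊻-nonzero : ∀ {t} (β β′ : Vec Bool t) → β ≢ β′ → β′ ⊻ β ≢ zeros
⊻-nonzero [] [] β≢β′ _ = β≢β′ refl
⊻-nonzero (b ∷ β) (b′ ∷ β′) β≢β′ sum≡0 =
  ⊻-nonzero β β′ (λ β≡β′ → β≢β′ (cong₂ _∷_ (xor-false (VecP.∷-injectiveˡ sum≡0)) β≡β′))
    (VecP.∷-injectiveʳ sum≡0)
  where
  xor-false : b′ xor b ≡ false → b ≡ b′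
  xor-false = from-yes (∀𝔹? λ x → ∀𝔹? λ y →
    (BoolP._≟_ (y xor x) false) →-dec (x BoolP.≟ y)) b b′

inner : ∀ {t} → Vec Bool t → ℕ → Bool
inner β n = xorsum β (λ j → bit n (toℕ j))

affine : (m : ℕ) → ℤ₄ → Vec Bool m → Word (2 ^ m)
affine m c β = tabulate (λ i → c +₄ twice (inner β (toℕ i)))

affine-⊕ : ∀ m c c′ β β′ → affine m c β ⊕ affine m c′ β′ ≡ affine m (c +₄ c′) (β ⊻ β′)
affine-⊕ m c c′ β β′ = trans (⊕-tabulate _ _) (VecP.tabulate-cong λ i →
  trans (shifted-+₄ c c′ (inner β (toℕ i)) (inner β′ (toℕ i)))
        (cong (λ p → (c +₄ c′) +₄ twice p) (sym (xorsum-⊻ β β′ _))))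

affine-⊖ : ∀ m c c′ β β′ → affine m c β ⊖ affine m c′ β′ ≡ affine m (c +₄ -₄ c′) (β ⊻ β′)
affine-⊖ m c c′ β β′ = begin
  affine m c β ⊕ map -₄_ (affine m c′ β′)  ≡⟨ cong (affine m c β ⊕_) (sym (VecP.tabulate-∘ -₄_ _)) ⟩
  affine m c β ⊕ tabulate (λ i → -₄ (c′ +₄ twice (inner β′ (toℕ i))))
                                           ≡⟨ cong (affine m c β ⊕_) (VecP.tabulate-cong λ i → shifted-−₄ c′ _) ⟩
  affine m c β ⊕ affine m (-₄ c′) β′       ≡⟨ affine-⊕ m c (-₄ c′) β β′ ⟩
  affine m (c +₄ -₄ c′) (β ⊻ β′)           ∎
  where open ≡-Reasoning

affine-const : ∀ m c → affine m c zeros ≡ replicate (2 ^ m) c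
affine-const m c = trans (VecP.tabulate-cong λ i →
    trans (cong (λ p → c +₄ twice p) (xorsum-zeros {m} (λ j → bit (toℕ i) (toℕ j)))) (+₄-identityʳ c))
  (tabulate-const c)

twoV-affine : ∀ m (j : Fin m) → twoV m j ≡ affine m 𝟘 (single j)
twoV-affine m j = VecP.tabulate-cong λ i → cong twice (sym (xorsum-single j _))

Σsel : ∀ {t d} → Vec Bool t → (Fin t → Word d) → Word d
Σsel [] g = 0w
Σsel (b ∷ β) g = (if b then g zero else 0w) ⊕ Σsel β (g ∘ suc)

Σsel-zrm : ∀ {m t} (β : Vec Bool t) (g : Fin t → Word (2 ^ m)) → (∀ j → ZRM m (g j)) → ZRM m (Σsel β g)
Σsel-zrm [] g g∈ = zrm-0
Σsel-zrm (true ∷ β) g g∈ = zrm-⊕ (g∈ zero) (Σsel-zrm β (g ∘ suc) (g∈ ∘ suc))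
Σsel-zrm (false ∷ β) g g∈ = zrm-⊕ zrm-0 (Σsel-zrm β (g ∘ suc) (g∈ ∘ suc))

Σsel-tabulate : ∀ {t d} (β : Vec Bool t) (h : Fin t → Fin d → Bool) →
                Σsel β (λ j → tabulate (twice ∘ h j)) ≡ tabulate (λ i → twice (xorsum β (λ j → h j i)))
Σsel-tabulate [] h = sym (tabulate-const 𝟘)
Σsel-tabulate (b ∷ β) h = begin
  (if b then tabulate (twice ∘ h zero) else 0w) ⊕ Σsel β _
    ≡⟨ cong₂ _⊕_ (selected b) (Σsel-tabulate β (h ∘ suc)) ⟩
  tabulate (λ i → twice (b ∧ h zero i)) ⊕ tabulate (λ i → twice (xorsum β (λ j → h (suc j) i)))
    ≡⟨ ⊕-tabulate _ _ ⟩
  tabulate (λ i → twice (b ∧ h zero i) +₄ twice (xorsum β (λ j → h (suc j) i)))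
    ≡⟨ VecP.tabulate-cong (λ i → twice-+₄ (b ∧ h zero i) (xorsum β (λ j → h (suc j) i))) ⟩
  tabulate (λ i → twice (xorsum (b ∷ β) (λ j → h j i)))  ∎
  where
  open ≡-Reasoning
  selected : ∀ b → (if b then tabulate (twice ∘ h zero) else 0w) ≡ tabulate (λ i → twice (b ∧ h zero i))
  selected true = refl
  selected false = sym (tabulate-const 𝟘)

affine-zrm : ∀ m c β → ZRM m (affine m c β)
affine-zrm m c β = subst (ZRM m) (sym split) (zrm-⊕ (replicate-zrm c) linear-part)
  where
  split : affine m c β ≡ replicate (2 ^ m) c ⊕ affine m 𝟘 β
  split = sym (trans (cong (_⊕ affine m 𝟘 β) (sym (tabulate-const c))) (⊕-tabulate _ _))
  linear-part : ZRM m (affine m 𝟘 β)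
  linear-part =
    subst (ZRM m) (Σsel-tabulate β (λ j i → bit (toℕ i) (toℕ j))) (Σsel-zrm β (twoV m) twoV-zrm)

zrm-affine : ∀ {m z} → ZRM m z → ∃₂ λ c β → z ≡ affine m c β
zrm-affine {m} zrm-0 = 𝟘 , zeros , sym (affine-const m 𝟘)
zrm-affine {m} (zrm-1 z∈) with zrm-affine z∈
... | c , β , refl = c +₄ 𝟙 , β ⊻ zeros ,
  trans (cong (affine m c β ⊕_) (sym (affine-const m 𝟙))) (affine-⊕ m c 𝟙 β zeros)
zrm-affine {m} (zrm-v j z∈) with zrm-affine z∈
... | c , β , refl = c +₄ 𝟘 , β ⊻ single j ,
  trans (cong (affine m c β ⊕_) (twoV-affine m j)) (affine-⊕ m c 𝟘 β (single j))

zrm-⊖ : ∀ {m x y} → ZRM m x → ZRM m y → ZRM m (x ⊖ y)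
zrm-⊖ {m} x∈ y∈ with zrm-affine x∈ | zrm-affine y∈
... | c , β , refl | c′ , β′ , refl =
  subst (ZRM m) (sym (affine-⊖ m c c′ β β′)) (affine-zrm m (c +₄ -₄ c′) (β ⊻ β′))

-- The Gray image.  ψφ sends each symbol to a ±1 pair; the inner product of
-- the pairs of a and b is χ(b − a), where χ(a) = 2·Re(√-1^a).

ψφ₁ : ℤ₄ → Vec ℤ 2
ψφ₁ a = ψ (φ₁ a)

ψφ-∷ : ∀ {d} a (x : Word d) → ψφ (a ∷ x) ≡ ψφ₁ a ++ ψφ x
ψφ-∷ a x = VecP.map-++ _ (φ₁ a) (φ x)

χ : ℤ₄ → ℤ
χ 𝟘 = + 2
χ 𝟙 = + 0
χ 𝟚 = ℤ.- + 2
χ 𝟛 = + 0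

dot-ψφ₁ : ∀ a b → dot (ψφ₁ a) (ψφ₁ b) ≡ χ (b +₄ -₄ a)
dot-ψφ₁ = from-yes (∀ℤ₄? λ a → ∀ℤ₄? λ b → dot (ψφ₁ a) (ψφ₁ b) ℤP.≟ χ (b +₄ -₄ a))

ψφ₁-injective : ∀ a b → ψφ₁ a ≡ ψφ₁ b → a ≡ b
ψφ₁-injective = from-yes (∀ℤ₄? λ a → ∀ℤ₄? λ b → VecP.≡-dec ℤP._≟_ (ψφ₁ a) (ψφ₁ b) →-dec (a ≟₄ b))

ψφ₁-antipode : ∀ a → ψφ₁ (a +₄ 𝟚) ≡ neg (ψφ₁ a)
ψφ₁-antipode = from-yes (∀ℤ₄? λ a → VecP.≡-dec ℤP._≟_ (ψφ₁ (a +₄ 𝟚)) (neg (ψφ₁ a)))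

-- corr w = Σ_i χ(w_i) = 2·Re(wt w).
corr : ∀ {d} → Word d → ℤ
corr [] = + 0
corr (a ∷ w) = χ a ℤ.+ corr w

dot-++ : ∀ {k n} (p q : Vec ℤ k) (r s : Vec ℤ n) → dot (p ++ r) (q ++ s) ≡ dot p q ℤ.+ dot r s
dot-++ [] [] r s = sym (ℤP.+-identityˡ (dot r s))
dot-++ (a ∷ p) (b ∷ q) r s =
  trans (cong (ℤ._+_ (a ℤ.* b)) (dot-++ p q r s)) (sym (ℤP.+-assoc (a ℤ.* b) _ _))

dot-ψφ : ∀ {d} (x y : Word d) → dot (ψφ x) (ψφ y) ≡ corr (y ⊖ x)
dot-ψφ [] [] = refl
dot-ψφ (a ∷ x) (b ∷ y) = begin
  dot (ψφ (a ∷ x)) (ψφ (b ∷ y))          ≡⟨ cong₂ dot (ψφ-∷ a x) (ψφ-∷ b y) ⟩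
  dot (ψφ₁ a ++ ψφ x) (ψφ₁ b ++ ψφ y)    ≡⟨ dot-++ (ψφ₁ a) (ψφ₁ b) (ψφ x) (ψφ y) ⟩
  dot (ψφ₁ a) (ψφ₁ b) ℤ.+ dot (ψφ x) (ψφ y) ≡⟨ cong₂ ℤ._+_ (dot-ψφ₁ a b) (dot-ψφ x y) ⟩
  χ (b +₄ -₄ a) ℤ.+ corr (y ⊖ x)          ∎
  where open ≡-Reasoning

ψφ-injective : ∀ {d} (x y : Word d) → ψφ x ≡ ψφ y → x ≡ y
ψφ-injective [] [] _ = refl
ψφ-injective (a ∷ x) (b ∷ y) eq
  with VecP.++-injective (ψφ₁ a) (ψφ₁ b) (trans (sym (ψφ-∷ a x)) (trans eq (ψφ-∷ b y)))
... | head≡ , tail≡ = cong₂ _∷_ (ψφ₁-injective a b head≡) (ψφ-injective x y tail≡)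

ψφ-antipode : ∀ {d} (x : Word d) → ψφ (x ⊕ replicate d 𝟚) ≡ neg (ψφ x)
ψφ-antipode [] = refl
ψφ-antipode (a ∷ x) = begin
  ψφ ((a +₄ 𝟚) ∷ (x ⊕ replicate _ 𝟚))      ≡⟨ ψφ-∷ (a +₄ 𝟚) (x ⊕ replicate _ 𝟚) ⟩
  ψφ₁ (a +₄ 𝟚) ++ ψφ (x ⊕ replicate _ 𝟚)  ≡⟨ cong₂ _++_ (ψφ₁-antipode a) (ψφ-antipode x) ⟩
  neg (ψφ₁ a) ++ neg (ψφ x)               ≡⟨ sym (VecP.map-++ _ (ψφ₁ a) (ψφ x)) ⟩
  neg (ψφ₁ a ++ ψφ x)                     ≡⟨ cong neg (sym (ψφ-∷ a x)) ⟩
  neg (ψφ (a ∷ x))                        ∎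
  where open ≡-Reasoning

corr-0w : ∀ {d} → corr (replicate d 𝟘) ≡ + (2 * d)
corr-0w {zero} = refl
corr-0w {suc d} = trans (cong (ℤ._+_ (+ 2)) (corr-0w {d})) (cong +_ (sym (ℕP.*-suc 2 d)))

self-dot : ∀ {d} (x : Word d) → dot (ψφ x) (ψφ x) ≡ + (2 * d)
self-dot {d} x = trans (dot-ψφ x x) (trans (cong corr (⊖-self x)) (corr-0w {d}))

dot-zeroˡ : ∀ {n} (w : Vec ℤ n) → dot (replicate n (+ 0)) w ≡ + 0
dot-zeroˡ [] = refl
dot-zeroˡ (a ∷ w) = trans (ℤP.+-identityˡ (dot (replicate _ (+ 0)) w)) (dot-zeroˡ w)

ψφ-nonzero : ∀ {d} → 0 < d → (x : Word d) → ψφ x ≢ replicate (d * 2) (+ 0)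
ψφ-nonzero {suc d} _ x ψφx≡0
  with trans (sym (self-dot x)) (trans (cong (λ v → dot v v) ψφx≡0) (dot-zeroˡ (replicate (suc d * 2) (+ 0))))
... | ()

Σ< : ℕ → (ℕ → ℤ) → ℤ
Σ< zero G = + 0
Σ< (suc n) G = G 0 ℤ.+ Σ< n (λ i → G (suc i))

Σ<-cong : ∀ n {G H : ℕ → ℤ} → (∀ i → G i ≡ H i) → Σ< n G ≡ Σ< n H
Σ<-cong zero G≡H = refl
Σ<-cong (suc n) G≡H = cong₂ ℤ._+_ (G≡H 0) (Σ<-cong n (λ i → G≡H (suc i)))

Σ<-zero : ∀ n → Σ< n (λ _ → + 0) ≡ + 0
Σ<-zero zero = refl
Σ<-zero (suc n) = trans (ℤP.+-identityˡ _) (Σ<-zero n)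

Σ<-+ : ∀ n (G H : ℕ → ℤ) → Σ< n (λ i → G i ℤ.+ H i) ≡ Σ< n G ℤ.+ Σ< n H
Σ<-+ zero G H = refl
Σ<-+ (suc n) G H = trans (cong (ℤ._+_ (G 0 ℤ.+ H 0)) (Σ<-+ n (λ i → G (suc i)) (λ i → H (suc i))))
                        (ℤ+-interchange (G 0) (H 0) _ _)

digit : Bool → ℕ
digit b = if b then 1 else 0

cons₂ : Bool → ℕ → ℕ
cons₂ b n = digit b + 2 * n

cons₂-suc : ∀ b n → cons₂ b (suc n) ≡ suc (suc (cons₂ b n))
cons₂-suc b n = begin
  digit b + 2 * suc n          ≡⟨ cong (_+_ (digit b)) (ℕP.*-suc 2 n) ⟩
  digit b + suc (suc (2 * n))  ≡⟨ ℕP.+-suc (digit b) (suc (2 * n)) ⟩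
  suc (digit b + suc (2 * n))  ≡⟨ cong suc (ℕP.+-suc (digit b) (2 * n)) ⟩
  suc (suc (cons₂ b n))        ∎
  where open ≡-Reasoning

Σ<-split : ∀ n (G : ℕ → ℤ) → Σ< (2 * n) G ≡ Σ< n (λ i → G (cons₂ false i) ℤ.+ G (cons₂ true i))
Σ<-split zero G = refl
Σ<-split (suc n) G = begin
  Σ< (2 * suc n) G
    ≡⟨ cong (λ k → Σ< k G) (ℕP.*-suc 2 n) ⟩
  G 0 ℤ.+ (G 1 ℤ.+ Σ< (2 * n) G⁺⁺)
    ≡⟨ sym (ℤP.+-assoc (G 0) (G 1) _) ⟩
  G 0 ℤ.+ G 1 ℤ.+ Σ< (2 * n) G⁺⁺
    ≡⟨ cong (ℤ._+_ (G 0 ℤ.+ G 1)) (trans (Σ<-split n G⁺⁺) (Σ<-cong n shift)) ⟩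
  G 0 ℤ.+ G 1 ℤ.+ Σ< n (λ i → G (cons₂ false (suc i)) ℤ.+ G (cons₂ true (suc i)))  ∎
  where
  open ≡-Reasoning
  G⁺⁺ : ℕ → ℤ
  G⁺⁺ i = G (suc (suc i))
  shift : ∀ i → G⁺⁺ (cons₂ false i) ℤ.+ G⁺⁺ (cons₂ true i)
              ≡ G (cons₂ false (suc i)) ℤ.+ G (cons₂ true (suc i))
  shift i = sym (cong₂ (λ k l → G k ℤ.+ G l) (cons₂-suc false i) (cons₂-suc true i))

odd-cons₂ : ∀ b n → odd (cons₂ b n) ≡ b
odd-cons₂ false zero = refl
odd-cons₂ true zero = refl
odd-cons₂ b (suc n) = trans (cong odd (cons₂-suc b n)) (trans (BoolP.not-involutive _) (odd-cons₂ b n))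

half-cons₂ : ∀ b n → ⌊ cons₂ b n /2⌋ ≡ n
half-cons₂ false zero = refl
half-cons₂ true zero = refl
half-cons₂ b (suc n) = trans (cong ⌊_/2⌋ (cons₂-suc b n)) (cong suc (half-cons₂ b n))

cons₂-odd-half : ∀ n → cons₂ (odd n) ⌊ n /2⌋ ≡ n
cons₂-odd-half zero = refl
cons₂-odd-half (suc zero) = refl
cons₂-odd-half (suc (suc n)) = begin
  cons₂ (not (not (odd n))) (suc ⌊ n /2⌋)
    ≡⟨ cong (λ b → cons₂ b (suc ⌊ n /2⌋)) (BoolP.not-involutive (odd n)) ⟩
  cons₂ (odd n) (suc ⌊ n /2⌋)              ≡⟨ cons₂-suc (odd n) ⌊ n /2⌋ ⟩
  suc (suc (cons₂ (odd n) ⌊ n /2⌋))        ≡⟨ cong (λ k → suc (suc k)) (cons₂-odd-half n) ⟩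
  suc (suc n)                              ∎
  where open ≡-Reasoning

cons₂-< : ∀ b {n N} → n < N → cons₂ b n < 2 * N
cons₂-< b {n} {N} n<N = ℕP.≤-trans (s≤s (ℕP.+-monoˡ-≤ (2 * n) (digit≤1 b)))
                          (ℕP.≤-trans (ℕP.≤-reflexive (sym (ℕP.*-suc 2 n))) (ℕP.*-monoʳ-≤ 2 n<N))
  where
  digit≤1 : ∀ b → digit b ≤ 1
  digit≤1 false = z≤n
  digit≤1 true = s≤s z≤n

half-< : ∀ {n N} → n < 2 * N → ⌊ n /2⌋ < N
half-< {n} {N} n<2N = subst (suc ⌊ n /2⌋ ≤_) (half-cons₂ true N) (ℕP.⌊n/2⌋-mono (s≤s n<2N))

bits : ℕ → (t : ℕ) → Vec Bool t
bits n zero = []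
bits n (suc t) = odd n ∷ bits ⌊ n /2⌋ t

bits-injective : ∀ t {n n′} → n < 2 ^ t → n′ < 2 ^ t → bits n t ≡ bits n′ t → n ≡ n′
bits-injective zero (s≤s z≤n) (s≤s z≤n) _ = refl
bits-injective (suc t) {n} {n′} n< n′< eq = begin
  n                          ≡⟨ sym (cons₂-odd-half n) ⟩
  cons₂ (odd n) ⌊ n /2⌋       ≡⟨ cong₂ cons₂ (VecP.∷-injectiveˡ eq)
                                 (bits-injective t (half-< n<) (half-< n′<) (VecP.∷-injectiveʳ eq)) ⟩
  cons₂ (odd n′) ⌊ n′ /2⌋     ≡⟨ cons₂-odd-half n′ ⟩
  n′                         ∎
  where open ≡-Reasoning

bits-surjective : ∀ {t} (γ : Vec Bool t) → ∃ λ n → n < 2 ^ t × bits n t ≡ γ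
bits-surjective [] = 0 , s≤s z≤n , refl
bits-surjective (b ∷ γ) with bits-surjective γ
... | n , n< , bits≡ = cons₂ b n , cons₂-< b n< ,
  cong₂ _∷_ (odd-cons₂ b n) (trans (cong (λ k → bits k _) (half-cons₂ b n)) bits≡)

corr-tabulate : ∀ d (g : ℕ → ℤ₄) → corr (tabulate {n = d} (g ∘ toℕ)) ≡ Σ< d (χ ∘ g)
corr-tabulate zero g = refl
corr-tabulate (suc d) g = cong (ℤ._+_ (χ (g 0))) (corr-tabulate d (λ i → g (suc i)))

inner-cons₂ : ∀ {t} b′ (β : Vec Bool t) b n → inner (b′ ∷ β) (cons₂ b n) ≡ (b′ ∧ b) xor inner β n
inner-cons₂ b′ β b n = cong₂ (λ x k → (b′ ∧ x) xor inner β k) (odd-cons₂ b n) (half-cons₂ b n)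

character-split : ∀ {m} b (β : Vec Bool m) →
  Σ< (2 ^ suc m) (λ n → χ (twice (inner (b ∷ β) n)))
    ≡ Σ< (2 ^ m) (λ i → χ (twice ((b ∧ false) xor inner β i)) ℤ.+ χ (twice ((b ∧ true) xor inner β i)))
character-split {m} b β = trans (Σ<-split (2 ^ m) _) (Σ<-cong (2 ^ m) λ i →
  cong₂ (λ p q → χ (twice p) ℤ.+ χ (twice q)) (inner-cons₂ b β false i) (inner-cons₂ b β true i))

-- A nonzero linear form on 𝔽₂^m takes both values equally often.
balanced : ∀ {m} (β : Vec Bool m) → β ≢ zeros → Σ< (2 ^ m) (λ n → χ (twice (inner β n))) ≡ + 0
balanced [] β≢0 = ⊥-elim (β≢0 refl)
balanced {suc m} (true ∷ β) _ =
  trans (character-split true β) (trans (Σ<-cong (2 ^ m) (cancels ∘ inner β)) (Σ<-zero (2 ^ m)))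
  where
  cancels : ∀ p → χ (twice p) ℤ.+ χ (twice (not p)) ≡ + 0
  cancels false = refl
  cancels true = refl
balanced {suc m} (false ∷ β) β≢0 =
  trans (character-split false β) (trans (Σ<-+ (2 ^ m) G G) (cong₂ ℤ._+_ G-balanced G-balanced))
  where
  G : ℕ → ℤ
  G n = χ (twice (inner β n))
  G-balanced : Σ< (2 ^ m) G ≡ + 0
  G-balanced = balanced β (β≢0 ∘ cong (false ∷_))

corr-affine-unit : ∀ m b b′ β → b ≢ b′ → corr (affine m (once b′ +₄ -₄ once b) β) ≡ + 0
corr-affine-unit m b b′ β b≢b′ =
  trans (corr-tabulate (2 ^ m) (λ n → (once b′ +₄ -₄ once b) +₄ twice (inner β n)))
        (trans (Σ<-cong (2 ^ m) (λ n → χ-unit b b′ (inner β n) b≢b′)) (Σ<-zero (2 ^ m)))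
  where
  -- χ vanishes on the odd elements of ℤ₄
  χ-unit : ∀ b b′ p → b ≢ b′ → χ ((once b′ +₄ -₄ once b) +₄ twice p) ≡ + 0
  χ-unit = from-yes (∀𝔹? λ b → ∀𝔹? λ b′ → ∀𝔹? λ p →
    ¬? (b BoolP.≟ b′) →-dec (χ ((once b′ +₄ -₄ once b) +₄ twice p) ℤP.≟ + 0))

corr-affine-linear : ∀ m β → β ≢ zeros → corr (affine m 𝟘 β) ≡ + 0
corr-affine-linear m β β≢0 = trans (corr-tabulate (2 ^ m) (λ n → twice (inner β n))) (balanced β β≢0)

module CosetPolytope (m : ℕ) (u : Word (2 ^ m)) where

  -- the representative u + b + 2⟨β,·⟩ of the antipodal pair indexed by b ∷ β
  rep : Vec Bool (suc m) → Word (2 ^ m)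
  rep (b ∷ β) = u ⊕ affine m (once b) β

  digits : Fin (2 ^ m * 2) → Vec Bool (suc m)
  digits k = bits (toℕ k) (suc m)

  toℕ<2^m+1 : (k : Fin (2 ^ m * 2)) → toℕ k < 2 ^ suc m
  toℕ<2^m+1 k = subst (toℕ k <_) (ℕP.*-comm (2 ^ m) 2) (FinP.toℕ<n k)

  digits-injective : ∀ k l → digits k ≡ digits l → k ≡ l
  digits-injective k l eq = FinP.toℕ-injective (bits-injective (suc m) (toℕ<2^m+1 k) (toℕ<2^m+1 l) eq)

  digits-surjective : ∀ γ → ∃ λ k → digits k ≡ γ
  digits-surjective γ with bits-surjective γ
  ... | n , n< , bits≡ =
    fromℕ< n<′ , trans (cong (λ k → bits k (suc m)) (FinP.toℕ-fromℕ< n<′)) bits≡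
    where
    n<′ : n < 2 ^ m * 2
    n<′ = subst (n <_) (ℕP.*-comm 2 (2 ^ m)) n<

  v : Fin (2 ^ m * 2) → Vec ℤ (2 ^ m * 2)
  v k = ψφ (rep (digits k))

  rep-orthogonal : ∀ γ γ′ → γ ≢ γ′ → dot (ψφ (rep γ)) (ψφ (rep γ′)) ≡ + 0
  rep-orthogonal (b ∷ β) (b′ ∷ β′) γ≢γ′ = begin
    dot (ψφ (rep (b ∷ β))) (ψφ (rep (b′ ∷ β′)))
      ≡⟨ dot-ψφ (rep (b ∷ β)) (rep (b′ ∷ β′)) ⟩
    corr (rep (b′ ∷ β′) ⊖ rep (b ∷ β))
      ≡⟨ cong corr (⊖-translate u _ _) ⟩
    corr (affine m (once b′) β′ ⊖ affine m (once b) β)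
      ≡⟨ cong corr (affine-⊖ m (once b′) (once b) β′ β) ⟩
    corr (affine m (once b′ +₄ -₄ once b) (β′ ⊻ β))
      ≡⟨ vanishes (b BoolP.≟ b′) ⟩
    + 0  ∎
    where
    open ≡-Reasoning
    vanishes : Dec (b ≡ b′) → corr (affine m (once b′ +₄ -₄ once b) (β′ ⊻ β)) ≡ + 0
    vanishes (no b≢b′) = corr-affine-unit m b b′ (β′ ⊻ β) b≢b′
    vanishes (yes refl) = trans (cong (λ c → corr (affine m c (β′ ⊻ β))) (−₄-self (once b)))
      (corr-affine-linear m (β′ ⊻ β) (⊻-nonzero β β′ (γ≢γ′ ∘ cong (b ∷_))))

  signed : Bool → Vec ℤ (2 ^ m * 2) → Vec ℤ (2 ^ m * 2)
  signed e y = if e then neg y else y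

  ψφ-shift : ∀ x e → ψφ (x ⊕ replicate (2 ^ m) (twice e)) ≡ signed e (ψφ x)
  ψφ-shift x false = cong ψφ (⊕-identityʳ x)
  ψφ-shift x true = ψφ-antipode x

  coset-rep : ∀ x → coset {m} u x → ∃₂ λ γ e → x ≡ rep γ ⊕ replicate (2 ^ m) (twice e)
  coset-rep x (z , z∈ , refl) with zrm-affine z∈
  ... | c , β , refl with once+twice c
  ...   | b , e , refl = b ∷ β , e , (begin
    u ⊕ affine m (once b +₄ twice e) β
      ≡⟨ cong (λ β′ → u ⊕ affine m _ β′) (sym (⊻-identityʳ β)) ⟩
    u ⊕ affine m (once b +₄ twice e) (β ⊻ zeros)
      ≡⟨ cong (u ⊕_) (sym (affine-⊕ m _ _ β zeros)) ⟩
    u ⊕ (affine m (once b) β ⊕ affine m (twice e) zeros)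
      ≡⟨ sym (⊕-assoc u _ _) ⟩
    rep (b ∷ β) ⊕ affine m (twice e) zeros
      ≡⟨ cong (rep (b ∷ β) ⊕_) (affine-const m (twice e)) ⟩
    rep (b ∷ β) ⊕ replicate (2 ^ m) (twice e)  ∎)
    where open ≡-Reasoning

  rep-coset : ∀ γ e → coset {m} u (rep γ ⊕ replicate (2 ^ m) (twice e))
  rep-coset (b ∷ β) e = affine m (once b) β ⊕ replicate (2 ^ m) (twice e) ,
    zrm-⊕ (affine-zrm m (once b) β) (replicate-zrm (twice e)) , ⊕-assoc u _ _

  P : Vec ℤ (2 ^ m * 2) → Set
  P = ψφ[ coset {m} u ]

  signed-in : ∀ k e y → y ≡ signed e (v k) → P y
  signed-in k e y y≡ = _ , rep-coset (digits k) e , trans y≡ (sym (ψφ-shift (rep (digits k)) e))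

  members : ∀ y → P y ⇔ (∃ λ k → y ≡ v k ⊎ y ≡ neg (v k))
  members y = mk⇔ to from
    where
    to : P y → ∃ λ k → y ≡ v k ⊎ y ≡ neg (v k)
    to (x , x∈ , refl) with coset-rep x x∈
    ... | γ , e , refl with digits-surjective γ
    ...   | k , refl with e
    ...     | false = k , inj₁ (ψφ-shift (rep γ) false)
    ...     | true = k , inj₂ (ψφ-shift (rep γ) true)
    from : (∃ λ k → y ≡ v k ⊎ y ≡ neg (v k)) → P y
    from (k , inj₁ y≡) = signed-in k false y y≡
    from (k , inj₂ y≡) = signed-in k true y y≡

  cross-polytope : IsCrossPolytope (2 ^ m * 2) P
  cross-polytope =
    v ,
    (λ k → ψφ-nonzero (ℕP.m^n>0 2 m) (rep (digits k))) ,
    (λ k l k≢l → rep-orthogonal (digits k) (digits l) (k≢l ∘ digits-injective k l)) ,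
    (λ k l → trans (self-dot (rep (digits k))) (sym (self-dot (rep (digits l))))) ,
    members

coset-difference : ∀ {m u x} → coset {m} u x → ZRM m (x ⊖ u)
coset-difference {u = u} (z , z∈ , refl) = subst (ZRM _) (sym (⊕-⊖-cancel u z)) z∈

difference-coset : ∀ {m u x} → ZRM m (x ⊖ u) → coset {m} u x
difference-coset {u = u} {x} x−u∈ = x ⊖ u , x−u∈ , sym (⊕-difference u x)

ψφ-cosets-meet : ∀ {m u u′ y} → ψφ[ coset {m} u ] y → ψφ[ coset {m} u′ ] y → ZRM m (u ⊖ u′)
ψφ-cosets-meet {m} {u} {u′} (x , x∈ , refl) (x′ , x′∈ , ψφx≡ψφx′)
  with ψφ-injective x x′ ψφx≡ψφx′
... | refl =
  subst (ZRM m) (⊖-common-minuend x u′ u) (zrm-⊖ (coset-difference x′∈) (coset-difference x∈))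

lemma4p3 : (m : ℕ) → 2 ≤ m →
    (C : Word (2 ^ m) → Set) → IsLinearCode C →
    (b : ℕ) → 0 < b → b < 2 ^ m →
    ValueSetIs C (valueList (2 ^ m) b) →
    (∀ x → ZRM m x → C x) →
    (f : ℕ) (u : Fin f → Word (2 ^ m)) → IsCosetReps {m} C f u →
    IsCrossPolytopeDecomposition (2 ^ m * 2) ψφ[ C ] f (λ i → ψφ[ coset {m} (u i) ])
lemma4p3 m _ C (_ , C-⊕ , _) _ _ _ _ ZRM⊆C f u (u∈C , covered , distinct) =
  (λ i → CosetPolytope.cross-polytope m (u i)) ,
  (λ i j y y∈i y∈j → distinct i j (ψφ-cosets-meet y∈i y∈j)) ,
  (λ y → mk⇔ into-coset out-of-coset)
  where
  into-coset : ∀ {y} → ψφ[ C ] y → ∃ λ i → ψφ[ coset {m} (u i) ] y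
  into-coset (x , x∈C , y≡) with covered x x∈C
  ... | i , x−u∈ = i , x , difference-coset x−u∈ , y≡
  out-of-coset : ∀ {y} → (∃ λ i → ψφ[ coset {m} (u i) ] y) → ψφ[ C ] y
  out-of-coset (i , x , (z , z∈ , x≡) , y≡) =
    x , subst C (sym x≡) (C-⊕ (u i) z (u∈C i) (ZRM⊆C z z∈)) , y≡
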